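{- Let $i\ge0$ be an integer and $G$ an $\alpha_i$-metric graph. Then for every vertex $v\notin C(G)$, $\operatorname{loc}(v)\le i+1$.
   Context: All graphs are finite, connected, unweighted, undirected, simple; $d(u,v)$ is the shortest-path distance. $I(u,v)=\{x: d(u,x)+d(x,v)=d(u,v)\}$. A graph is $\alpha_i$-metric if for all vertices $u,w,v,x$: whenever $v\in I(u,w)$, $w\in I(v,x)$ and $vw$ is an edge, then $d(u,x)\ge d(u,v)+d(v,x)-i$. $e(v)=\max_u d(u,v)$; $\operatorname{rad}(G)=\min_v e(v)$; $C(G)=\{v:e(v)=\operatorname{rad}(G)\}$. For $v\notin C(G)$, the locality is $\operatorname{loc}(v)=\min\{d(v,x): e(x)<e(v)\}$. -}

module Defs where

open import Data.Nat using (ℕ; zero; suc; _+_; _∸_; _≤_; _<_; _⊔_; _⊓_)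
open import Data.Bool using (Bool; true; false; _∧_; _∨_; T)
open import Data.Fin using (Fin; zero)
open import Data.Fin.Properties using (_≟_)
open import Data.List using (List; foldr; map)
open import Data.Bool.ListAction using (any)
open import Data.List.Base using (allFin)
open import Data.Product using (_×_; ∃)
open import Relation.Nullary using (¬_)
open import Relation.Nullary.Decidable using (⌊_⌋)
open import Relation.Binary.PropositionalEquality using (_≡_)

record Graph (n : ℕ) : Set where
  field
    adj       : Fin n → Fin n → Bool
    symmetric : ∀ u v → adj u v ≡ adj v u
    irreflex  : ∀ u → adj u u ≡ false

open Graph public

data Walk {n : ℕ} (G : Graph n) : Fin n → Fin n → ℕ → Set where
  here : ∀ {u} → Walk G u u 0
  step : ∀ {u w v k} → T (adj G u w) → Walk G w v k → Walk G u v (suc k)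

Connected : ∀ {n} → Graph n → Set
Connected G = ∀ u v → ∃ λ k → Walk G u v k

reach : ∀ {n} → Graph n → ℕ → Fin n → Fin n → Bool
reach G zero    u v = ⌊ u ≟ v ⌋
reach {n} G (suc k) u v = reach G k u v ∨ any (λ w → reach G k u w ∧ adj G w v) (allFin n)

search : ∀ {n} → Graph n → Fin n → Fin n → ℕ → ℕ → ℕ
search G u v j zero       = j
search G u v j (suc fuel) with reach G j u v
... | true  = j
... | false = search G u v (suc j) fuel

-- Shortest-path distance d(u,v): the least k such that a walk of length ≤ k exists.
-- In a connected graph on n vertices, d(u,v) ≤ n, so searching up to n suffices.
dist : ∀ {n} → Graph n → Fin n → Fin n → ℕ
dist {n} G u v = search G u v 0 n

InInterval : ∀ {n} → Graph n → Fin n → Fin n → Fin n → Set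
InInterval G u v x = dist G u x + dist G x v ≡ dist G u v

AlphaMetric : ∀ {n} → ℕ → Graph n → Set
AlphaMetric i G = ∀ u w v x →
  InInterval G u w v → InInterval G v x w → T (adj G v w) →
  dist G u v + dist G v x ≤ dist G u x + i

maxList : List ℕ → ℕ
maxList = foldr _⊔_ 0

ecc : ∀ {n} → Graph n → Fin n → ℕ
ecc {n} G v = maxList (map (λ u → dist G u v) (allFin n))

rad : ∀ {n} → Graph (suc n) → ℕ
rad {n} G = foldr _⊓_ (ecc G zero) (map (ecc G) (allFin (suc n)))

InCenter : ∀ {n} → Graph (suc n) → Fin (suc n) → Set
InCenter G v = ecc G v ≡ rad G

module Submission where

-- Let c be central, so e(c) < e(v), and walk from c towards v along a geodesic. At the first
-- edge yz where the eccentricity climbs back to at least e(v) (e(y) < e(v) ≤ e(z)), take u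
-- farthest from z. Then d(u,y) < e(z) ≤ d(u,y) + 1, so y ∈ I(u,z), while z ∈ I(y,v); the
-- α_i-inequality gives d(u,y) + d(y,v) ≤ d(u,v) + i ≤ e(z) + i = d(u,y) + 1 + i, so y is a
-- vertex with e(y) < e(v) and d(v,y) ≤ i + 1.

open import Defs
open import Data.Nat using (ℕ; zero; suc; _≤_; _<_; _+_; _⊔_; _⊓_; z≤n; s≤s; _≤′_; ≤′-refl; ≤′-step)
open import Data.Nat.Properties
open import Data.Fin using (Fin; zero; toℕ)
open import Data.Fin.Properties using (pigeonhole; toℕ≤pred[n])
open import Data.Bool using (T; true; false; _∧_)
open import Data.Bool.Properties using (T-∨; T-∧)
open import Data.List using (map; foldr; allFin)
open import Data.List.Properties using (foldr-preservesᵒ)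
import Data.List.Relation.Unary.Any as Any
open import Data.List.Relation.Unary.Any.Properties using (any⁺; any⁻)
open import Data.List.Membership.Propositional using (_∈_; lose)
open import Data.List.Membership.Propositional.Properties
  using (∈-allFin; ∈-map⁺; ∈-map⁻; foldr-selective)
open import Data.Product using (∃; ∃₂; _×_; _,_; proj₁; proj₂)
open import Data.Sum using (_⊎_; inj₁; inj₂; [_,_])
open import Function using (_∘_)
open import Function.Bundles using (Equivalence)
open import Relation.Nullary using (¬_; yes; no; contradiction)
open import Relation.Nullary.Decidable using (fromWitness; toWitness; T?)
open import Relation.Binary.PropositionalEquality hiding ([_])

adj-sym : ∀ {n} (G : Graph n) {u v} → T (adj G u v) → T (adj G v u)
adj-sym G {u} {v} = subst T (symmetric G u v)

≤-foldr-⊔ : ∀ {x} e {xs} → x ∈ xs → x ≤ foldr _⊔_ e xs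
≤-foldr-⊔ e {xs} x∈xs = foldr-preservesᵒ
  (λ a b → [ m≤n⇒m≤n⊔o b , m≤n⇒m≤o⊔n a ]) e xs (inj₂ (Any.map ≤-reflexive x∈xs))

foldr-⊓-≤ : ∀ {x} e {xs} → x ∈ xs → foldr _⊓_ e xs ≤ x
foldr-⊓-≤ e {xs} x∈xs = foldr-preservesᵒ
  (λ a b → [ m≤n⇒m⊓o≤n b , m≤n⇒o⊓m≤n a ]) e xs (inj₂ (Any.map (≤-reflexive ∘ sym) x∈xs))

module Reachability {n : ℕ} (G : Graph n) where

  -- Wrapping T (reach G k u v) in a record keeps k, u and v inferable from the type.
  record Reach (k : ℕ) (u v : Fin n) : Set where
    constructor reached
    field reach-true : T (reach G k u v)

  Reach0⇒≡ : ∀ {u v} → Reach 0 u v → u ≡ v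
  Reach0⇒≡ (reached r) = toWitness r

  Reach-refl : ∀ {u} → Reach 0 u u
  Reach-refl = reached (fromWitness refl)

  Reach-suc : ∀ {k u v} → Reach k u v → Reach (suc k) u v
  Reach-suc {k} {u} {v} (reached r) =
    reached (Equivalence.from (T-∨ {reach G k u v}) (inj₁ r))

  Reach-snoc : ∀ {k u w v} → Reach k u w → T (adj G w v) → Reach (suc k) u v
  Reach-snoc {k} {u} {w} {v} (reached r) e =
    reached (Equivalence.from (T-∨ {reach G k u v}) (inj₂ (any⁺ (λ x → reach G k u x ∧ adj G x v) w∈)))
    where
      w∈ : Any.Any (λ x → T (reach G k u x ∧ adj G x v)) (allFin n)
      w∈ = lose (∈-allFin w) (Equivalence.from (T-∧ {reach G k u w}) (r , e))

  Reach-unsnoc : ∀ {k u v} → Reach (suc k) u v →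
                 Reach k u v ⊎ ∃ λ w → Reach k u w × T (adj G w v)
  Reach-unsnoc {k} {u} {v} (reached r) with Equivalence.to (T-∨ {reach G k u v}) r
  ... | inj₁ r′ = inj₁ (reached r′)
  ... | inj₂ r′ with Any.satisfied (any⁻ (λ x → reach G k u x ∧ adj G x v) (allFin n) r′)
  ... | w , rw = let r″ , e = Equivalence.to (T-∧ {reach G k u w}) rw in inj₂ (w , reached r″ , e)

  Reach-mono : ∀ {j k u v} → j ≤ k → Reach j u v → Reach k u v
  Reach-mono j≤k = go (≤⇒≤′ j≤k)
    where
      go : ∀ {j k u v} → j ≤′ k → Reach j u v → Reach k u v
      go ≤′-refl      r = r
      go (≤′-step j≤k) r = Reach-suc (go j≤k r)

  Reach-trans : ∀ a b {u w v} → Reach a u w → Reach b w v → Reach (a + b) u v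
  Reach-trans a zero r s rewrite Reach0⇒≡ s | +-identityʳ a = r
  Reach-trans a (suc b) r s rewrite +-suc a b with Reach-unsnoc s
  ... | inj₁ s′           = Reach-suc (Reach-trans a b r s′)
  ... | inj₂ (_ , s′ , e) = Reach-snoc (Reach-trans a b r s′) e

  Reach-cons : ∀ {k u w v} → T (adj G u w) → Reach k w v → Reach (suc k) u v
  Reach-cons {k} e r = Reach-trans 1 k (Reach-snoc Reach-refl e) r

  Reach-sym : ∀ k {u v} → Reach k u v → Reach k v u
  Reach-sym zero r rewrite Reach0⇒≡ r = Reach-refl
  Reach-sym (suc k) r with Reach-unsnoc r
  ... | inj₁ r′           = Reach-suc (Reach-sym k r′)
  ... | inj₂ (_ , r′ , e) = Reach-cons (adj-sym G e) (Reach-sym k r′)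

  Walk⇒Reach : ∀ {u v k} → Walk G u v k → Reach k u v
  Walk⇒Reach here       = Reach-refl
  Walk⇒Reach (step e w) = Reach-cons e (Walk⇒Reach w)

module Distance {n : ℕ} (G : Graph n) where
  open Reachability G

  IsDistance : Fin n → Fin n → ℕ → Set
  IsDistance u v k = Reach k u v × (∀ j → j < k → ¬ Reach j u v)

  isDistance-exists : ∀ m {u v} → Reach m u v → ∃ (IsDistance u v)
  isDistance-exists zero r = zero , r , λ _ ()
  isDistance-exists (suc m) {u} {v} r with T? (reach G m u v)
  ... | yes r′ = isDistance-exists m (reached r′)
  ... | no ¬r′ = suc m , r , λ j j≤m rj → ¬r′ (Reach.reach-true (Reach-mono (≤-pred j≤m) rj))

  isDistance-unique : ∀ {u v a b} → IsDistance u v a → IsDistance u v b → a ≡ b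
  isDistance-unique (ra , min-a) (rb , min-b) =
    ≤-antisym (≮⇒≥ λ b<a → min-a _ b<a rb) (≮⇒≥ λ a<b → min-b _ a<b ra)

  isDistance-sym : ∀ {u v k} → IsDistance u v k → IsDistance v u k
  isDistance-sym {k = k} (r , min) = Reach-sym k r , λ j j<k rj → min j j<k (Reach-sym j rj)

  isDistance-triangle : ∀ {u w v a b c} →
    IsDistance u w a → IsDistance w v b → IsDistance u v c → c ≤ a + b
  isDistance-triangle {a = a} {b} (ra , _) (rb , _) (_ , min-c) =
    ≮⇒≥ λ a+b<c → min-c _ a+b<c (Reach-trans a b ra rb)

  isDistance-predecessor : ∀ {v y k} → IsDistance v y (suc k) →
    ∃ λ z → T (adj G z y) × IsDistance v z k
  isDistance-predecessor {k = k} (r , min) with Reach-unsnoc r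
  ... | inj₁ r′ = contradiction r′ (min k ≤-refl)
  ... | inj₂ (w , rw , e) with isDistance-exists k rw
  ... | j , dw@(rj , min-j) with j ≟ k
  ... | yes refl = w , e , dw
  ... | no j≢k   = contradiction (Reach-snoc rj e) (min (suc j) (s≤s j<k))
    where
      j<k : j < k
      j<k = ≤∧≢⇒< (≮⇒≥ λ k<j → min-j k k<j rw) j≢k

  isDistance-layer : ∀ m {v y} → IsDistance v y m → ∀ j → j ≤ m → ∃ λ z → IsDistance v z j
  isDistance-layer zero    {y = y} d j j≤0 rewrite n≤0⇒n≡0 j≤0 = y , d
  isDistance-layer (suc m) {y = y} d j j≤1+m with j ≟ suc m
  ... | yes refl = y , d
  ... | no j≢1+m =
    let z , _ , dz = isDistance-predecessor d
    in  isDistance-layer m dz j (≤-pred (≤∧≢⇒< j≤1+m j≢1+m))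

  -- The m + 1 distance layers along a geodesic are pairwise distinct vertices (pigeonhole).
  isDistance<n : ∀ {v y m} → IsDistance v y m → m < n
  isDistance<n {v} {m = m} d = ≮⇒≥ λ n<1+m → layers-disjoint (pigeonhole n<1+m layer)
    where
      layer : Fin (suc m) → Fin n
      layer j = proj₁ (isDistance-layer m d (toℕ j) (toℕ≤pred[n] j))

      layer-dist : ∀ j → IsDistance v (layer j) (toℕ j)
      layer-dist j = proj₂ (isDistance-layer m d (toℕ j) (toℕ≤pred[n] j))

      layers-disjoint : ¬ ∃₂ λ i j → toℕ i < toℕ j × layer i ≡ layer j
      layers-disjoint (i , j , i<j , eq) =
        <-irrefl (isDistance-unique (layer-dist i) layer-i-dist-j) i<j
        where
          layer-i-dist-j : IsDistance v (layer i) (toℕ j)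
          layer-i-dist-j = subst (λ z → IsDistance v z (toℕ j)) (sym eq) (layer-dist j)

  search-isDistance : ∀ {u v k} → IsDistance u v k → ∀ j fuel → j ≤ k → k ≤ j + fuel →
    (∀ j′ → j′ < j → ¬ Reach j′ u v) → search G u v j fuel ≡ k
  search-isDistance {k = k} d j zero j≤k k≤j+0 _ = ≤-antisym j≤k (subst (k ≤_) (+-identityʳ j) k≤j+0)
  search-isDistance {u} {v} {k} d@(r , min) j (suc fuel) j≤k k≤j+1+fuel below-j
    with reach G j u v in eq
  ... | true  = ≤-antisym j≤k (≮⇒≥ λ k<j → min j k<j (reached (subst T (sym eq) _)))
  ... | false = search-isDistance d (suc j) fuel j<k (subst (k ≤_) (+-suc j fuel) k≤j+1+fuel) below-1+j
    where
      ¬Reach-j : ¬ Reach j u v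
      ¬Reach-j (reached rj) = subst T eq rj

      j<k : j < k
      j<k = ≤∧≢⇒< j≤k λ { refl → ¬Reach-j r }

      below-1+j : ∀ j′ → j′ < suc j → ¬ Reach j′ u v
      below-1+j j′ j′<1+j with j′ ≟ j
      ... | yes refl = ¬Reach-j
      ... | no j′≢j  = below-j j′ (≤∧≢⇒< (≤-pred j′<1+j) j′≢j)

  isDistance⇒dist≡ : ∀ {u v k} → IsDistance u v k → dist G u v ≡ k
  isDistance⇒dist≡ d = search-isDistance d 0 n z≤n (<⇒≤ (isDistance<n d)) λ _ ()

  dist-refl : ∀ {u} → dist G u u ≡ 0
  dist-refl = isDistance⇒dist≡ (Reach-refl , λ _ ())

  dist-adj : ∀ {u w} → T (adj G u w) → dist G u w ≡ 1
  dist-adj {u} {w} e = isDistance⇒dist≡ (Reach-snoc Reach-refl e , λ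
    { zero _ r → subst T (irreflex G w) (subst (λ x → T (adj G x w)) (Reach0⇒≡ r) e)
    ; (suc _) (s≤s ()) _ })

  module _ (connected : Connected G) where

    dist-isDistance : ∀ u v → IsDistance u v (dist G u v)
    dist-isDistance u v =
      let k , d = isDistance-exists _ (Walk⇒Reach (proj₂ (connected u v)))
      in  subst (IsDistance u v) (sym (isDistance⇒dist≡ d)) d

    dist-sym : ∀ u v → dist G u v ≡ dist G v u
    dist-sym u v = isDistance⇒dist≡ (isDistance-sym (dist-isDistance v u))

    dist-triangle : ∀ u w v → dist G u v ≤ dist G u w + dist G w v
    dist-triangle u w v =
      isDistance-triangle (dist-isDistance u w) (dist-isDistance w v) (dist-isDistance u v)

    dist-predecessor : ∀ {v y k} → dist G v y ≡ suc k →
      ∃ λ z → T (adj G z y) × dist G v z ≡ k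
    dist-predecessor {v} {y} eq =
      let z , e , dz = isDistance-predecessor (subst (IsDistance v y) eq (dist-isDistance v y))
      in  z , e , isDistance⇒dist≡ dz

module Eccentricity {n : ℕ} (G : Graph n) where

  dist≤ecc : ∀ u x → dist G u x ≤ ecc G x
  dist≤ecc u x = ≤-foldr-⊔ 0 (∈-map⁺ (λ w → dist G w x) (∈-allFin u))

  -- When the maximum is the default 0, the vertex itself attains it.
  ecc-attained : ∀ x → ∃ λ u → dist G u x ≡ ecc G x
  ecc-attained x with foldr-selective ⊔-sel 0 (map (λ w → dist G w x) (allFin n))
  ... | inj₁ ecc≡0 = x , trans (Distance.dist-refl G) (sym ecc≡0)
  ... | inj₂ ecc∈ =
    let u , _ , eq = ∈-map⁻ (λ w → dist G w x) {xs = allFin n} ecc∈ in u , sym eq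

module Radius {n : ℕ} (G : Graph (suc n)) where

  rad≤ecc : ∀ v → rad G ≤ ecc G v
  rad≤ecc v = foldr-⊓-≤ (ecc G zero) (∈-map⁺ (ecc G) (∈-allFin v))

  rad-attained : ∃ λ c → ecc G c ≡ rad G
  rad-attained with foldr-selective ⊓-sel (ecc G zero) (map (ecc G) (allFin (suc n)))
  ... | inj₁ rad≡ecc₀ = zero , sym rad≡ecc₀
  ... | inj₂ rad∈ =
    let c , _ , eq = ∈-map⁻ (ecc G) {xs = allFin (suc n)} rad∈ in c , sym eq

  ¬InCenter⇒ecc-not-minimal : ∀ {v} → ¬ InCenter G v → ∃ λ c → ecc G c < ecc G v
  ¬InCenter⇒ecc-not-minimal {v} v∉C =
    let c , c∈C = rad-attained
    in  c , subst (_< ecc G v) (sym c∈C) (≤∧≢⇒< (rad≤ecc v) (v∉C ∘ sym))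

module _ {i n : ℕ} (G : Graph n) (connected : Connected G) (α : AlphaMetric i G) where
  open Distance G
  open Eccentricity G

  ecc-rise⇒dist≤i+1 : ∀ {y z v} → T (adj G y z) → InInterval G y v z →
    ecc G y < ecc G v → ecc G v ≤ ecc G z → dist G y v ≤ i + 1
  ecc-rise⇒dist≤i+1 {y} {z} {v} yz z∈I[y,v] ey<ev ev≤ez =
    subst (dist G y v ≤_) (+-comm 1 i) (+-cancelˡ-≤ a _ _ α-bound)
    where
      open ≤-Reasoning
      u = proj₁ (ecc-attained z)
      a = dist G u y

      du≡ez : dist G u z ≡ ecc G z
      du≡ez = proj₂ (ecc-attained z)

      a<ez : a < ecc G z
      a<ez = begin-strict a ≤⟨ dist≤ecc u y ⟩ ecc G y <⟨ ey<ev ⟩ ecc G v ≤⟨ ev≤ez ⟩ ecc G z ∎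

      a+1≡ez : a + 1 ≡ ecc G z
      a+1≡ez = ≤-antisym
        (subst (_≤ ecc G z) (+-comm 1 a) a<ez)
        (begin
          ecc G z                 ≡⟨ du≡ez ⟨
          dist G u z              ≤⟨ dist-triangle connected u y z ⟩
          a + dist G y z          ≡⟨ cong (a +_) (dist-adj yz) ⟩
          a + 1                   ∎)

      y∈I[u,z] : InInterval G u z y
      y∈I[u,z] = trans (cong (a +_) (dist-adj yz)) (trans a+1≡ez (sym du≡ez))

      α-bound : a + dist G y v ≤ a + (1 + i)
      α-bound = begin
        a + dist G y v   ≤⟨ α u z y v y∈I[u,z] z∈I[y,v] yz ⟩
        dist G u v + i   ≤⟨ +-monoˡ-≤ i (≤-trans (dist≤ecc u v) ev≤ez) ⟩
        ecc G z + i      ≡⟨ cong (_+ i) a+1≡ez ⟨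
        a + 1 + i        ≡⟨ +-assoc a 1 i ⟩
        a + (1 + i)      ∎

  lower-ecc-within-i+1 : ∀ {v} k y → dist G v y ≡ k → ecc G y < ecc G v →
    ∃ λ x → ecc G x < ecc G v × dist G v x ≤ i + 1
  lower-ecc-within-i+1 zero y dvy≡0 ey<ev = y , ey<ev , ≤-trans (≤-reflexive dvy≡0) z≤n
  lower-ecc-within-i+1 {v} (suc k) y dvy≡1+k ey<ev
    with z , zy , dvz≡k ← dist-predecessor connected dvy≡1+k
    with ecc G z <? ecc G v
  ... | yes ez<ev = lower-ecc-within-i+1 k z dvz≡k ez<ev
  ... | no ez≮ev  = y , ey<ev ,
    subst (_≤ i + 1) (dist-sym connected y v)
      (ecc-rise⇒dist≤i+1 (adj-sym G zy) z∈I[y,v] ey<ev (≮⇒≥ ez≮ev))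
    where
      z∈I[y,v] : InInterval G y v z
      z∈I[y,v] = begin
        dist G y z + dist G z v ≡⟨ cong₂ _+_ (dist-adj (adj-sym G zy)) (trans (dist-sym connected z v) dvz≡k) ⟩
        suc k                   ≡⟨ trans (dist-sym connected y v) dvy≡1+k ⟨
        dist G y v              ∎
        where open ≡-Reasoning

lemma7 : (i n : ℕ) (G : Graph (suc n)) → Connected G → AlphaMetric i G →
    (v : Fin (suc n)) → ¬ InCenter G v →
    ∃ λ x → (ecc G x < ecc G v) × (dist G v x ≤ i + 1)
lemma7 i n G connected α v v∉C =
  let c , ec<ev = Radius.¬InCenter⇒ecc-not-minimal G v∉C
  in  lower-ecc-within-i+1 G connected α (dist G v c) c refl ec<ev
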